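{- For every odd integer $n>1$, the number $Y_n=2178\times uz(n)$ is a reverse divisor.
   Context: For $n\ge1$, $uz(n)$ denotes the $n$-digit decimal number whose digits, read from left to right, are $1,0,1,0,\dots$ (starting with $1$ and alternating), e.g. $uz(3)=101$, $uz(5)=10101$. Reverse divisor: a non-palindromic positive integer $x$ with $n\ge 2$ decimal digits is a reverse divisor if its reverse $x'$ (the integer whose decimal digits are those of $x$ in reverse order) satisfies $x'=k\cdot x$ for some integer $k$ with $1<k<10$. -}

module Defs where

open import Data.Nat using (ℕ; zero; suc; _+_; _*_; _<_; _≤_)
open import Data.Nat.DivMod using (_/_; _%_)
open import Data.List using (List; []; _∷_; length; reverse)
open import Data.Product using (Σ; _×_; ∃-syntax)
open import Relation.Binary.PropositionalEquality using (_≡_)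
open import Relation.Nullary using (¬_)

-- Decimal digits of x, least significant first; digits 0 = [].
-- The fuel argument f only needs to be ≥ x (each step divides by 10).
digitsLE-aux : ℕ → ℕ → List ℕ
digitsLE-aux zero    _       = []
digitsLE-aux (suc f) zero    = []
digitsLE-aux (suc f) (suc x) = (suc x % 10) ∷ digitsLE-aux f (suc x / 10)

digitsLE : ℕ → List ℕ
digitsLE x = digitsLE-aux x x

digits : ℕ → List ℕ
digits x = reverse (digitsLE x)

fromDigits-aux : ℕ → List ℕ → ℕ
fromDigits-aux acc []       = acc
fromDigits-aux acc (d ∷ ds) = fromDigits-aux (10 * acc + d) ds

fromDigits : List ℕ → ℕ
fromDigits = fromDigits-aux 0

numDigits : ℕ → ℕ
numDigits x = length (digits x)

rev : ℕ → ℕ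
rev x = fromDigits (reverse (digits x))

Palindrome : ℕ → Set
Palindrome x = reverse (digits x) ≡ digits x

-- uz n : the n-digit number 1010... (starting with 1, alternating).
-- uz (n+1) = 10 * uz n + (1 if n even else 0).
uz : ℕ → ℕ
uz zero = 0
uz (suc n) = 10 * uz n + (if-even n)
  where
  if-even : ℕ → ℕ
  if-even zero = 1
  if-even (suc zero) = 0
  if-even (suc (suc m)) = if-even m

ReverseDivisor : ℕ → Set
ReverseDivisor x =
  0 < x × 2 ≤ numDigits x × ¬ Palindrome x ×
  ∃[ k ] (1 < k × k < 10 × rev x ≡ k * x)

Odd : ℕ → Set
Odd n = ∃[ m ] (n ≡ 2 * m + 1)

-- Y = 2178 · uz(2m+1) has decimal expansion 2 1 9⋯9 7 8 (with 2m nines):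
-- both Y + 22 and the reversal of that expansion plus 88 are multiples of
-- 22 · 10^(2m+2), with ratio 4, so the reverse of Y is 4 · Y.  Y is built as
-- the value of that digit list, from which digits recovers the list.
module Submission where

open import Defs
open import Data.Nat using (ℕ; zero; suc; _+_; _*_; _^_; _<_; _≤_; z≤n; s≤s; >-nonZero)
open import Data.Nat.Properties
open import Data.Nat.DivMod
open import Data.Nat.Divisibility using (divides-refl)
open import Data.List using (List; []; _∷_; _++_; reverse; length; replicate)
open import Data.List.Properties using (reverse-++; length-reverse; reverse-involutive)
open import Data.Product using (_,_; _×_; proj₁; proj₂)
open import Data.Empty using (⊥-elim)
open import Relation.Nullary using (¬_)
open import Relation.Binary.PropositionalEquality
open import Data.Nat.Tactic.RingSolver using (solve-∀)

open ≡-Reasoning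

valueLE : List ℕ → ℕ
valueLE []       = 0
valueLE (d ∷ ds) = d + valueLE ds * 10

-- Little-endian decimal expansions of positive numbers: the last digit is the
-- leading one and must be nonzero.
data Canonical : List ℕ → Set where
  leading : ∀ {d} → d < 10 → 0 < d → Canonical (d ∷ [])
  _∷_     : ∀ {d ds} → d < 10 → Canonical ds → Canonical (d ∷ ds)

valueLE-pos : ∀ {ds} → Canonical ds → 0 < valueLE ds
valueLE-pos (leading {d} _ 0<d) = ≤-trans 0<d (m≤m+n d 0)
valueLE-pos (_∷_ {d} {ds} _ c)  =
  ≤-trans (valueLE-pos c) (≤-trans (m≤m*n (valueLE ds) 10) (m≤n+m _ d))

[d+q*10]%10≡d : ∀ {d} q → d < 10 → (d + q * 10) % 10 ≡ d
[d+q*10]%10≡d {d} q d<10 = trans ([m+kn]%n≡m%n d q 10) (m<n⇒m%n≡m d<10)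

[d+q*10]/10≡q : ∀ {d} q → d < 10 → (d + q * 10) / 10 ≡ q
[d+q*10]/10≡q {d} q d<10 = begin
  (d + q * 10) / 10     ≡⟨ +-distrib-/-∣ʳ d (divides-refl q) ⟩
  d / 10 + q * 10 / 10  ≡⟨ cong₂ _+_ (m<n⇒m/n≡0 d<10) (m*n/n≡m q 10) ⟩
  q                     ∎

digitsLE-aux-zero : ∀ f → digitsLE-aux f 0 ≡ []
digitsLE-aux-zero zero    = refl
digitsLE-aux-zero (suc f) = refl

digitsLE-aux-suc : ∀ f {v} → 0 < v → digitsLE-aux (suc f) v ≡ v % 10 ∷ digitsLE-aux f (v / 10)
digitsLE-aux-suc f {suc v} _ = refl

digitsLE-aux-cons : ∀ {d} f q → d < 10 → 0 < d + q * 10 →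
                    digitsLE-aux (suc f) (d + q * 10) ≡ d ∷ digitsLE-aux f q
digitsLE-aux-cons f q d<10 pos = trans (digitsLE-aux-suc f pos)
  (cong₂ _∷_ ([d+q*10]%10≡d q d<10) (cong (digitsLE-aux f) ([d+q*10]/10≡q q d<10)))

digitsLE-aux-valueLE : ∀ {ds} f → Canonical ds → valueLE ds ≤ f →
                       digitsLE-aux f (valueLE ds) ≡ ds
digitsLE-aux-valueLE zero c le = ⊥-elim (n≮0 (≤-trans (valueLE-pos c) le))
digitsLE-aux-valueLE (suc f) c@(leading {d} d<10 _) _ = begin
  digitsLE-aux (suc f) (d + 0)  ≡⟨ digitsLE-aux-cons f 0 d<10 (valueLE-pos c) ⟩
  d ∷ digitsLE-aux f 0          ≡⟨ cong (d ∷_) (digitsLE-aux-zero f) ⟩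
  d ∷ []                        ∎
digitsLE-aux-valueLE (suc f) c@(_∷_ {d} {ds} d<10 c′) le = begin
  digitsLE-aux (suc f) (d + q * 10)  ≡⟨ digitsLE-aux-cons f q d<10 (valueLE-pos c) ⟩
  d ∷ digitsLE-aux f q               ≡⟨ cong (d ∷_) (digitsLE-aux-valueLE f c′ q≤f) ⟩
  d ∷ ds                             ∎
  where
  q = valueLE ds
  q≤f : q ≤ f
  q≤f = <⇒≤pred (<-≤-trans (m<m*n q 10 {{>-nonZero (valueLE-pos c′)}} (s≤s (s≤s z≤n)))
                            (≤-trans (m≤n+m (q * 10) d) le))

digits-valueLE : ∀ {ds} → Canonical ds → digits (valueLE ds) ≡ reverse ds
digits-valueLE c = cong reverse (digitsLE-aux-valueLE _ c ≤-refl)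

rev-valueLE : ∀ {ds} → Canonical ds → rev (valueLE ds) ≡ fromDigits ds
rev-valueLE {ds} c = cong fromDigits (trans (cong reverse (digits-valueLE c)) (reverse-involutive ds))

fromDigits-aux-++ : ∀ a xs ys → fromDigits-aux a (xs ++ ys) ≡ fromDigits-aux (fromDigits-aux a xs) ys
fromDigits-aux-++ a []       ys = refl
fromDigits-aux-++ a (x ∷ xs) ys = fromDigits-aux-++ (10 * a + x) xs ys

valueLE-nines-++ : ∀ k ys → valueLE (replicate k 9 ++ ys) + 1 ≡ (valueLE ys + 1) * 10 ^ k
valueLE-nines-++ zero    ys = sym (*-identityʳ _)
valueLE-nines-++ (suc k) ys = begin
  9 + v * 10 + 1             ≡⟨ shift v ⟩
  (v + 1) * 10               ≡⟨ cong (_* 10) (valueLE-nines-++ k ys) ⟩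
  (w + 1) * 10 ^ k * 10      ≡⟨ reassoc w (10 ^ k) ⟩
  (w + 1) * (10 * 10 ^ k)    ∎
  where
  v = valueLE (replicate k 9 ++ ys)
  w = valueLE ys
  shift : ∀ v → 9 + v * 10 + 1 ≡ (v + 1) * 10
  shift = solve-∀
  reassoc : ∀ w p → (w + 1) * p * 10 ≡ (w + 1) * (10 * p)
  reassoc = solve-∀

fromDigits-aux-nines : ∀ k a → fromDigits-aux a (replicate k 9) + 1 ≡ (a + 1) * 10 ^ k
fromDigits-aux-nines zero    a = sym (*-identityʳ _)
fromDigits-aux-nines (suc k) a = begin
  fromDigits-aux (10 * a + 9) (replicate k 9) + 1  ≡⟨ fromDigits-aux-nines k (10 * a + 9) ⟩
  (10 * a + 9 + 1) * 10 ^ k                        ≡⟨ shift a (10 ^ k) ⟩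
  (a + 1) * (10 * 10 ^ k)                          ∎
  where
  shift : ∀ a p → (10 * a + 9 + 1) * p ≡ (a + 1) * (10 * p)
  shift = solve-∀

Y-digitsLE : ℕ → List ℕ
Y-digitsLE k = 8 ∷ 7 ∷ replicate k 9 ++ 1 ∷ 2 ∷ []

Y : ℕ → ℕ
Y k = valueLE (Y-digitsLE k)

Y-canonical : ∀ k → Canonical (Y-digitsLE k)
Y-canonical k = <ᵇ⇒< 8 10 _ ∷ (<ᵇ⇒< 7 10 _ ∷ nines k)
  where
  nines : ∀ k → Canonical (replicate k 9 ++ 1 ∷ 2 ∷ [])
  nines zero    = <ᵇ⇒< 1 10 _ ∷ leading (<ᵇ⇒< 2 10 _) (<ᵇ⇒< 0 2 _)
  nines (suc k) = <ᵇ⇒< 9 10 _ ∷ nines k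

Y+22 : ∀ k → Y k + 22 ≡ 2200 * 10 ^ k
Y+22 k = begin
  8 + (7 + v * 10) * 10 + 22  ≡⟨ shift v ⟩
  (v + 1) * 100               ≡⟨ cong (_* 100) (valueLE-nines-++ k (1 ∷ 2 ∷ [])) ⟩
  22 * 10 ^ k * 100           ≡⟨ reassoc (10 ^ k) ⟩
  2200 * 10 ^ k               ∎
  where
  v = valueLE (replicate k 9 ++ 1 ∷ 2 ∷ [])
  shift : ∀ v → 8 + (7 + v * 10) * 10 + 22 ≡ (v + 1) * 100
  shift = solve-∀
  reassoc : ∀ p → 22 * p * 100 ≡ 2200 * p
  reassoc = solve-∀

fromDigits-Y+88 : ∀ k → fromDigits (Y-digitsLE k) + 88 ≡ 4 * (2200 * 10 ^ k)
fromDigits-Y+88 k = begin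
  fromDigits (Y-digitsLE k) + 88  ≡⟨ cong (_+ 88) (fromDigits-aux-++ 87 (replicate k 9) (1 ∷ 2 ∷ [])) ⟩
  10 * (10 * b + 1) + 2 + 88      ≡⟨ shift b ⟩
  (b + 1) * 100                   ≡⟨ cong (_* 100) (fromDigits-aux-nines k 87) ⟩
  88 * 10 ^ k * 100               ≡⟨ reassoc (10 ^ k) ⟩
  4 * (2200 * 10 ^ k)             ∎
  where
  b = fromDigits-aux 87 (replicate k 9)
  shift : ∀ b → 10 * (10 * b + 1) + 2 + 88 ≡ (b + 1) * 100
  shift = solve-∀
  reassoc : ∀ p → 88 * p * 100 ≡ 4 * (2200 * p)
  reassoc = solve-∀

rev-Y : ∀ k → rev (Y k) ≡ 4 * Y k
rev-Y k = trans (rev-valueLE (Y-canonical k)) (+-cancelʳ-≡ 88 _ _ (begin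
  fromDigits (Y-digitsLE k) + 88  ≡⟨ fromDigits-Y+88 k ⟩
  4 * (2200 * 10 ^ k)             ≡⟨ cong (4 *_) (Y+22 k) ⟨
  4 * (Y k + 22)                  ≡⟨ *-distribˡ-+ 4 (Y k) 22 ⟩
  4 * Y k + 88                    ∎))

Y-not-palindrome : ∀ k → ¬ Palindrome (Y k)
Y-not-palindrome k p = 8≢2 (begin
  Y-digitsLE k                      ≡⟨ reverse-involutive (Y-digitsLE k) ⟨
  reverse (reverse (Y-digitsLE k))  ≡⟨ subst (λ xs → reverse xs ≡ xs) (digits-valueLE (Y-canonical k)) p ⟩
  reverse (Y-digitsLE k)            ≡⟨ reverse-++ (8 ∷ 7 ∷ replicate k 9) (1 ∷ 2 ∷ []) ⟩
  2 ∷ 1 ∷ reverse (8 ∷ 7 ∷ replicate k 9) ∎)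
  where
  8≢2 : ∀ {xs ys : List ℕ} → ¬ 8 ∷ xs ≡ 2 ∷ ys
  8≢2 ()

Y-reverseDivisor : ∀ k → ReverseDivisor (Y k)
Y-reverseDivisor k =
  s≤s z≤n , two-digits , Y-not-palindrome k , 4 , <ᵇ⇒< 1 4 _ , <ᵇ⇒< 4 10 _ , rev-Y k
  where
  two-digits : 2 ≤ numDigits (Y k)
  two-digits = subst (2 ≤_)
    (sym (trans (cong length (digits-valueLE (Y-canonical k))) (length-reverse (Y-digitsLE k))))
    (s≤s (s≤s z≤n))

-- The parity digit of uz is hidden in a local function of its definition;
-- cancellation against the previous step recovers its value at even positions.
uz-suc-parity : ∀ m → uz (suc (m * 2)) ≡ 10 * uz (m * 2) + 1 × uz (suc (suc (m * 2))) ≡ 10 * uz (suc (m * 2))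
uz-suc-parity zero    = refl , refl
uz-suc-parity (suc m) =
    cong (10 * uz (suc (suc (m * 2))) +_) (+-cancelˡ-≡ (10 * uz (m * 2)) _ _ (proj₁ ih))
  , trans (cong (10 * uz (suc (suc (suc (m * 2)))) +_)
                (+-cancelˡ-≡ (10 * uz (suc (m * 2))) _ _ (trans (proj₂ ih) (sym (+-identityʳ _)))))
          (+-identityʳ _)
  where
  ih = uz-suc-parity m

uz-odd-suc : ∀ m → uz (suc (suc m * 2)) ≡ 100 * uz (suc (m * 2)) + 1
uz-odd-suc m = begin
  uz (suc (suc m * 2))              ≡⟨ proj₁ (uz-suc-parity (suc m)) ⟩
  10 * uz (suc (suc (m * 2))) + 1   ≡⟨ cong (λ u → 10 * u + 1) (proj₂ (uz-suc-parity m)) ⟩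
  10 * (10 * uz (suc (m * 2))) + 1  ≡⟨ cong (_+ 1) (*-assoc 10 10 (uz (suc (m * 2)))) ⟨
  100 * uz (suc (m * 2)) + 1        ∎

2178*uz-odd+22 : ∀ m → 2178 * uz (suc (m * 2)) + 22 ≡ 2200 * 10 ^ (m * 2)
2178*uz-odd+22 zero    = refl
2178*uz-odd+22 (suc m) = begin
  2178 * uz (suc (suc m * 2)) + 22  ≡⟨ cong (λ u → 2178 * u + 22) (uz-odd-suc m) ⟩
  2178 * (100 * u + 1) + 22         ≡⟨ shift u ⟩
  100 * (2178 * u + 22)             ≡⟨ cong (100 *_) (2178*uz-odd+22 m) ⟩
  100 * (2200 * 10 ^ (m * 2))       ≡⟨ reassoc (10 ^ (m * 2)) ⟩
  2200 * 10 ^ (suc m * 2)           ∎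
  where
  u = uz (suc (m * 2))
  shift : ∀ u → 2178 * (100 * u + 1) + 22 ≡ 100 * (2178 * u + 22)
  shift = solve-∀
  reassoc : ∀ p → 100 * (2200 * p) ≡ 2200 * (10 * (10 * p))
  reassoc = solve-∀

2178*uz-odd≡Y : ∀ m → 2178 * uz (suc (m * 2)) ≡ Y (m * 2)
2178*uz-odd≡Y m = +-cancelʳ-≡ 22 _ _ (trans (2178*uz-odd+22 m) (sym (Y+22 (m * 2))))

corollary7 : (n : ℕ) → Odd n → 1 < n → ReverseDivisor (2178 * uz n)
corollary7 n (m , n≡2m+1) _ = subst (λ n → ReverseDivisor (2178 * uz n)) (sym n≡suc[m*2])
  (subst ReverseDivisor (sym (2178*uz-odd≡Y m)) (Y-reverseDivisor (m * 2)))
  where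
  n≡suc[m*2] : n ≡ suc (m * 2)
  n≡suc[m*2] = trans n≡2m+1 (trans (+-comm (2 * m) 1) (cong suc (*-comm 2 m)))
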